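{- Let $m\ge 3$ be an integer and let $\mathscr{A}=(A_{n,k})_{n\ge k\ge 0}$ be an infinite lower triangular matrix with $A_{n,k}\ne 0$ for all $n\ge k\ge 0$. Then $\mathscr{A}\in SDR_{m+1}$ if and only if $\mathscr{A}\in SDR_m$.
   Context: All matrices are infinite lower triangular matrices $\mathscr{A}=(A_{n,k})_{n\ge k\ge 0}$ with complex entries; we set $A_{n,k}=0$ whenever $k>n$. For an integer $m\ge 3$, $\mathscr{A}$ is called an SDR-matrix of order $m$ (written $\mathscr{A}\in SDR_m$) if for all integers $n,k\ge 0$, all $2\le p\le m-1$ and all $0\le r\le p-1$, $$\prod_{i=0}^{r}A_{n+i,k+r-i}\prod_{i=0}^{p-r-1}A_{n+p-i,k+r+i+1}=\prod_{i=0}^{r}A_{n+p-i,k+p-r+i}\prod_{i=0}^{p-r-1}A_{n+i,k+p-r-i-1}.$$ -}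

module Defs where

open import Level using (Level)
open import Data.Nat using (ℕ; zero; suc; _+_; _∸_; _≤_; _<_)
open import Data.Product using (Σ; _×_)
open import Relation.Nullary using (¬_)
open import Algebra.Bundles using (CommutativeRing)

module _ {c ℓ : Level} (R : CommutativeRing c ℓ) where
  open CommutativeRing R using (Carrier; _≈_; _*_; 1#; 0#)

  IsField : Set (c Level.⊔ ℓ)
  IsField = (¬ (1# ≈ 0#)) × (∀ x → ¬ (x ≈ 0#) → Σ Carrier (λ y → x * y ≈ 1#))

  prod : ℕ → (ℕ → Carrier) → Carrier
  prod zero    f = 1#
  prod (suc n) f = prod n f * f n

  IsLowerTriangular : (ℕ → ℕ → Carrier) → Set ℓ
  IsLowerTriangular A = ∀ n k → n < k → A n k ≈ 0#

  SDR : ℕ → (ℕ → ℕ → Carrier) → Set ℓ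
  SDR m A = ∀ n k p r → 2 ≤ p → suc p ≤ m → suc r ≤ p →
      prod (suc r) (λ i → A (n + i) (k + r ∸ i))
        * prod (p ∸ r) (λ i → A (n + p ∸ i) (k + r + i + 1))
    ≈ prod (suc r) (λ i → A (n + p ∸ i) (k + p ∸ r + i))
        * prod (p ∸ r) (λ i → A (n + i) (k + p ∸ r ∸ i ∸ 1))

-- Write T(n,k,a) for the product of the a+1 entries on the antidiagonal segment from (n,k+a) down
-- to (n+a,k). For p = r+1+q the SDR identity of (n,k,p,r) reads
--   T(n,k,r) · T(n+r+1,k+r+1,q) = T(n+q+1,k+q+1,r) · T(n,k,q),
-- and the case p = 2, r = 0, available once m ≥ 3, is a hexagon relation between six neighbouring
-- entries. In diagonal coordinates B(d,k) = A(d+k,k) with invertible entries, the hexagon relation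
-- determines B from its values on the rows d = 0, 1 and the column k = 0, and every product
-- X(d+k) Y(k) Z(d) satisfies it; choosing X, Y, Z to fit those boundary values shows
-- A(n,k) = X(n) Y(k) Z(n-k) on the triangle. For such a matrix both sides of the antidiagonal
-- identity contain the same X- and Y-segments and the same Z-values, while outside the triangle a
-- factor on each side vanishes. Hence SDR_m implies SDR of every order.
module Submission where

open import Defs
open import Level using (Level)
open import Data.Nat using (ℕ; zero; suc; _+_; _∸_; _≤_; _<_; z≤n; s≤s; _<?_)
import Data.Nat.Properties as ℕ
open import Data.Nat.Tactic.RingSolver using (solve-∀)
open import Data.Product using (_×_; _,_; proj₁; proj₂)
open import Data.Sum using (inj₁; inj₂)
open import Relation.Nullary using (¬_; yes; no)
open import Relation.Binary.PropositionalEquality as ≡ using (_≡_; refl; cong; cong₂)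
open import Algebra.Bundles using (CommutativeRing)
import Algebra.Definitions as AlgebraDefinitions
import Algebra.Properties.CommutativeSemigroup as CommutativeSemigroupProperties
import Algebra.Solver.CommutativeMonoid as CommutativeMonoidSolver
import Relation.Binary.Reasoning.Setoid as SetoidReasoning

1+m+n∸m≡1+n : ∀ m n → suc m + n ∸ m ≡ suc n
1+m+n∸m≡1+n m n = ≡.trans (cong (_∸ m) (≡.sym (ℕ.+-suc m n))) (ℕ.m+n∸m≡n m (suc n))

m+[1+n+o]∸n≡m+[1+o] : ∀ m n o → m + (suc n + o) ∸ n ≡ m + suc o
m+[1+n+o]∸n≡m+[1+o] m n o =
  ≡.trans (cong (_∸ n) (reassoc m n o)) (ℕ.m+n∸m≡n n (m + suc o))
  where
  reassoc : ∀ m n o → m + (suc n + o) ≡ n + (m + suc o)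
  reassoc = solve-∀

m+[n+o]∸p≡m+n+[o∸p] : ∀ m n {o p} → p ≤ o → m + (n + o) ∸ p ≡ m + n + (o ∸ p)
m+[n+o]∸p≡m+n+[o∸p] m n {o} {p} p≤o = begin
  m + (n + o) ∸ p   ≡⟨ ℕ.+-∸-assoc m (ℕ.≤-trans p≤o (ℕ.m≤n+m o n)) ⟩
  m + (n + o ∸ p)   ≡⟨ cong (m +_) (ℕ.+-∸-assoc n p≤o) ⟩
  m + (n + (o ∸ p)) ≡⟨ ≡.sym (ℕ.+-assoc m n (o ∸ p)) ⟩
  m + n + (o ∸ p)   ∎
  where open ≡.≡-Reasoning

m+[1+n]∸o∸1≡m+[n∸o] : ∀ m {n o} → o ≤ n → m + suc n ∸ o ∸ 1 ≡ m + (n ∸ o)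
m+[1+n]∸o∸1≡m+[n∸o] m {n} {o} o≤n = begin
  m + suc n ∸ o ∸ 1                 ≡⟨ ℕ.∸-+-assoc (m + suc n) o 1 ⟩
  m + suc n ∸ (o + 1)               ≡⟨ cong (λ x → m + suc x ∸ (o + 1)) (≡.sym (ℕ.m∸n+n≡m o≤n)) ⟩
  m + suc (n ∸ o + o) ∸ (o + 1)     ≡⟨ cong (_∸ (o + 1)) (reassoc m (n ∸ o) o) ⟩
  m + (n ∸ o) + (o + 1) ∸ (o + 1)   ≡⟨ ℕ.m+n∸n≡m (m + (n ∸ o)) (o + 1) ⟩
  m + (n ∸ o)                       ∎
  where
  open ≡.≡-Reasoning
  reassoc : ∀ m x o → m + suc (x + o) ≡ m + x + (o + 1)
  reassoc = solve-∀

[m+o+i]∸[n+o+j]≡[m+i]∸[n+j] : ∀ m n o i j → m + o + i ∸ (n + o + j) ≡ m + i ∸ (n + j)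
[m+o+i]∸[n+o+j]≡[m+i]∸[n+j] m n o i j =
  ≡.trans (cong₂ _∸_ (reassoc m o i) (reassoc n o j)) (ℕ.[m+n]∸[m+o]≡n∸o o (m + i) (n + j))
  where
  reassoc : ∀ x o y → x + o + y ≡ o + (x + y)
  reassoc = solve-∀

m+n+o≡m+o+n : ∀ m n o → m + n + o ≡ m + o + n
m+n+o≡m+o+n = solve-∀

+-shift-≤ : ∀ k a {n} s → k + a ≤ n → k + s + a ≤ n + s
+-shift-≤ k a {n} s k+a≤n = ≡.subst (_≤ n + s) (m+n+o≡m+o+n k a s) (ℕ.+-monoˡ-≤ s k+a≤n)

+-shift-< : ∀ {n} k a s → n < k + a → n + s < k + s + a
+-shift-< {n} k a s n<k+a = ≡.subst (n + s <_) (m+n+o≡m+o+n k a s) (ℕ.+-monoˡ-< s n<k+a)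

module _ {c ℓ : Level} (R : CommutativeRing c ℓ) where
  open CommutativeRing R
    using (Carrier; _≈_; _*_; 0#; 1#; setoid; *-cong; *-comm; *-assoc; *-identityˡ; *-identityʳ;
           zeroˡ; zeroʳ; *-commutativeSemigroup; *-commutativeMonoid)
    renaming (refl to ≈-refl; sym to ≈-sym; trans to ≈-trans; reflexive to ≈-reflexive)
  open AlgebraDefinitions _≈_ using (RightInvertible)
  open CommutativeSemigroupProperties *-commutativeSemigroup
    using (interchange; x∙yz≈y∙xz; x∙yz≈y∙zx)
  open CommutativeMonoidSolver *-commutativeMonoid using (solve; _⊜_; _⊕_; id)
  open SetoidReasoning setoid

  Invertible : Carrier → Set (c Level.⊔ ℓ)
  Invertible = RightInvertible 1# _*_

  entry-cong : ∀ (M : ℕ → ℕ → Carrier) {n n′ k k′} → n ≡ n′ → k ≡ k′ → M n k ≈ M n′ k′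
  entry-cong M n≡n′ k≡k′ = ≈-reflexive (cong₂ M n≡n′ k≡k′)

  interchange₃ : ∀ x₁ x₂ x₃ y₁ y₂ y₃ →
                 (x₁ * x₂ * x₃) * (y₁ * y₂ * y₃) ≈ (x₁ * y₁) * (x₂ * y₂) * (x₃ * y₃)
  interchange₃ = solve 6 (λ x₁ x₂ x₃ y₁ y₂ y₃ →
    ((x₁ ⊕ x₂) ⊕ x₃) ⊕ ((y₁ ⊕ y₂) ⊕ y₃) ⊜ ((x₁ ⊕ y₁) ⊕ (x₂ ⊕ y₂)) ⊕ (x₃ ⊕ y₃)) ≈-refl

  *-≈1 : ∀ {x y} → x ≈ 1# → y ≈ 1# → x * y ≈ 1#
  *-≈1 x≈1 y≈1 = ≈-trans (*-cong x≈1 y≈1) (*-identityˡ 1#)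

  *-identityʳ-≈1 : ∀ x {u} → u ≈ 1# → x * u ≈ x
  *-identityʳ-≈1 x u≈1 = ≈-trans (*-cong ≈-refl u≈1) (*-identityʳ x)

  *-invertible : ∀ {x y} → Invertible x → Invertible y → Invertible (x * y)
  *-invertible (x⁻¹ , xx⁻¹≈1) (y⁻¹ , yy⁻¹≈1) = x⁻¹ * y⁻¹ , (begin
    (_ * _) * (x⁻¹ * y⁻¹) ≈⟨ interchange _ _ _ _ ⟩
    (_ * x⁻¹) * (_ * y⁻¹) ≈⟨ *-≈1 xx⁻¹≈1 yy⁻¹≈1 ⟩
    1#                    ∎)

  *-cancelʳ-invertible : ∀ {x y z} → Invertible z → x * z ≈ y * z → x ≈ y
  *-cancelʳ-invertible {x} {y} {z} (z⁻¹ , zz⁻¹≈1) xz≈yz = begin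
    x              ≈⟨ ≈-sym (*-identityʳ x) ⟩
    x * 1#         ≈⟨ *-cong ≈-refl (≈-sym zz⁻¹≈1) ⟩
    x * (z * z⁻¹)  ≈⟨ ≈-sym (*-assoc x z z⁻¹) ⟩
    x * z * z⁻¹    ≈⟨ *-cong xz≈yz ≈-refl ⟩
    y * z * z⁻¹    ≈⟨ *-assoc y z z⁻¹ ⟩
    y * (z * z⁻¹)  ≈⟨ *-cong ≈-refl zz⁻¹≈1 ⟩
    y * 1#         ≈⟨ *-identityʳ y ⟩
    y              ∎

  *-cong-zeroˡ : ∀ {x y u v} → x ≈ 0# → y ≈ 0# → x * u ≈ y * v
  *-cong-zeroˡ x≈0 y≈0 =
    ≈-trans (≈-trans (*-cong x≈0 ≈-refl) (zeroˡ _)) (≈-sym (≈-trans (*-cong y≈0 ≈-refl) (zeroˡ _)))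

  *-cong-zeroʳ : ∀ {x y u v} → u ≈ 0# → v ≈ 0# → x * u ≈ y * v
  *-cong-zeroʳ u≈0 v≈0 =
    ≈-trans (≈-trans (*-cong ≈-refl u≈0) (zeroʳ _)) (≈-sym (≈-trans (*-cong ≈-refl v≈0) (zeroʳ _)))

  -- Products

  prod-cong : ∀ a {f g : ℕ → Carrier} → (∀ i → i < a → f i ≈ g i) → prod R a f ≈ prod R a g
  prod-cong zero    f≈g = ≈-refl
  prod-cong (suc a) f≈g =
    *-cong (prod-cong a (λ i i<a → f≈g i (ℕ.m<n⇒m<1+n i<a))) (f≈g a (ℕ.n<1+n a))

  prod-length : ∀ {a b} (f : ℕ → Carrier) → a ≡ b → prod R a f ≈ prod R b f
  prod-length f a≡b = ≈-reflexive (cong (λ l → prod R l f) a≡b)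

  prod-distrib-* : ∀ a (f g : ℕ → Carrier) → prod R a (λ i → f i * g i) ≈ prod R a f * prod R a g
  prod-distrib-* zero    f g = ≈-sym (*-identityˡ 1#)
  prod-distrib-* (suc a) f g = begin
    prod R a (λ i → f i * g i) * (f a * g a) ≈⟨ *-cong (prod-distrib-* a f g) ≈-refl ⟩
    (prod R a f * prod R a g) * (f a * g a) ≈⟨ interchange _ _ _ _ ⟩
    prod R (suc a) f * prod R (suc a) g     ∎

  prod-suc : ∀ a (f : ℕ → Carrier) → prod R (suc a) f ≈ f 0 * prod R a (λ i → f (suc i))
  prod-suc zero    f = *-comm 1# (f 0)
  prod-suc (suc a) f = begin
    prod R (suc a) f * f (suc a)                      ≈⟨ *-cong (prod-suc a f) ≈-refl ⟩
    f 0 * prod R a (λ i → f (suc i)) * f (suc a)      ≈⟨ *-assoc _ _ _ ⟩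
    f 0 * prod R (suc a) (λ i → f (suc i))            ∎

  prod-+ : ∀ a b (f : ℕ → Carrier) → prod R (a + b) f ≈ prod R a f * prod R b (λ i → f (a + i))
  prod-+ zero    b f = ≈-sym (*-identityˡ _)
  prod-+ (suc a) b f = begin
    prod R (suc (a + b)) f                                          ≈⟨ prod-suc (a + b) f ⟩
    f 0 * prod R (a + b) (λ i → f (suc i))                          ≈⟨ *-cong ≈-refl (prod-+ a b (λ i → f (suc i))) ⟩
    f 0 * (prod R a (λ i → f (suc i)) * prod R b (λ i → f (suc a + i))) ≈⟨ ≈-sym (*-assoc _ _ _) ⟩
    f 0 * prod R a (λ i → f (suc i)) * prod R b (λ i → f (suc a + i))   ≈⟨ *-cong (≈-sym (prod-suc a f)) ≈-refl ⟩
    prod R (suc a) f * prod R b (λ i → f (suc a + i))               ∎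

  prod-reverse : ∀ a (f : ℕ → Carrier) → prod R (suc a) (λ i → f (a ∸ i)) ≈ prod R (suc a) f
  prod-reverse zero    f = ≈-refl
  prod-reverse (suc a) f = begin
    prod R (suc (suc a)) (λ i → f (suc a ∸ i))        ≈⟨ prod-suc (suc a) (λ i → f (suc a ∸ i)) ⟩
    f (suc a) * prod R (suc a) (λ i → f (a ∸ i))      ≈⟨ *-cong ≈-refl (prod-reverse a f) ⟩
    f (suc a) * prod R (suc a) f                      ≈⟨ *-comm _ _ ⟩
    prod R (suc (suc a)) f                            ∎

  prod-zero : ∀ {a j} (f : ℕ → Carrier) → j < a → f j ≈ 0# → prod R a f ≈ 0#
  prod-zero {suc a} f (s≤s j≤a) fj≈0 with ℕ.m≤n⇒m<n∨m≡n j≤a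
  ... | inj₁ j<a  = ≈-trans (*-cong (prod-zero f j<a fj≈0) ≈-refl) (zeroˡ _)
  ... | inj₂ refl = ≈-trans (*-cong ≈-refl fj≈0) (zeroʳ _)

  segment : (ℕ → Carrier) → ℕ → ℕ → Carrier
  segment f n a = prod R (suc a) (λ i → f (n + i))

  segment-+ : ∀ (f : ℕ → Carrier) n a b →
              segment f n a * segment f (n + suc a) b ≈ prod R (suc a + suc b) (λ i → f (n + i))
  segment-+ f n a b = ≈-sym (≈-trans (prod-+ (suc a) (suc b) (λ i → f (n + i)))
    (*-cong ≈-refl (prod-cong (suc b) (λ i _ → ≈-reflexive (cong f (≡.sym (ℕ.+-assoc n (suc a) i)))))))

  segment-swap : ∀ (f : ℕ → Carrier) n a b →
                 segment f n a * segment f (n + suc a) b ≈ segment f (n + suc b) a * segment f n b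
  segment-swap f n a b = begin
    segment f n a * segment f (n + suc a) b      ≈⟨ segment-+ f n a b ⟩
    prod R (suc a + suc b) (λ i → f (n + i))     ≈⟨ prod-length _ (ℕ.+-comm (suc a) (suc b)) ⟩
    prod R (suc b + suc a) (λ i → f (n + i))     ≈⟨ ≈-sym (segment-+ f n b a) ⟩
    segment f n b * segment f (n + suc b) a      ≈⟨ *-comm _ _ ⟩
    segment f (n + suc b) a * segment f n b      ∎

  -- Hexagon relation and factorisation in diagonal coordinates

  Hexagon : (ℕ → ℕ → Carrier) → Set ℓ
  Hexagon f = ∀ e k → f (suc e) k * (f e (suc (suc k)) * f (suc (suc e)) (suc k))
                    ≈ f (suc e) (suc (suc k)) * (f e (suc k) * f (suc (suc e)) k)

  factorised-hexagon : ∀ (X Y Z : ℕ → Carrier) → Hexagon (λ d k → X (d + k) * Y k * Z d)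
  factorised-hexagon X Y Z e k
    rewrite ℕ.+-suc e (suc k) | ℕ.+-suc e k = shape _ _ _ _ _ _ _ _ _
    where
    shape : ∀ x₁ x₂ x₃ y₀ y₁ y₂ z₀ z₁ z₂ →
            (x₁ * y₀ * z₁) * ((x₂ * y₂ * z₀) * (x₃ * y₁ * z₂))
            ≈ (x₃ * y₂ * z₁) * ((x₁ * y₁ * z₀) * (x₂ * y₀ * z₂))
    shape = solve 9 (λ x₁ x₂ x₃ y₀ y₁ y₂ z₀ z₁ z₂ →
      ((x₁ ⊕ y₀) ⊕ z₁) ⊕ (((x₂ ⊕ y₂) ⊕ z₀) ⊕ ((x₃ ⊕ y₁) ⊕ z₂))
      ⊜ ((x₃ ⊕ y₂) ⊕ z₁) ⊕ (((x₁ ⊕ y₁) ⊕ z₀) ⊕ ((x₂ ⊕ y₀) ⊕ z₂))) ≈-refl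

  module _ {f g : ℕ → ℕ → Carrier} (hex-f : Hexagon f) (hex-g : Hexagon g) where

    hexagon-step : ∀ {e k} → Invertible (f (suc e) k * f e (suc (suc k))) →
                   f (suc e) k ≈ g (suc e) k → f e (suc (suc k)) ≈ g e (suc (suc k)) →
                   f (suc e) (suc (suc k)) ≈ g (suc e) (suc (suc k)) →
                   f e (suc k) ≈ g e (suc k) → f (suc (suc e)) k ≈ g (suc (suc e)) k →
                   f (suc (suc e)) (suc k) ≈ g (suc (suc e)) (suc k)
    hexagon-step {e} {k} inv eq₁ eq₂ eq₃ eq₄ eq₅ = *-cancelʳ-invertible inv (begin
      f (suc (suc e)) (suc k) * (f (suc e) k * f e (suc (suc k)))
        ≈⟨ x∙yz≈y∙zx _ _ _ ⟩
      f (suc e) k * (f e (suc (suc k)) * f (suc (suc e)) (suc k))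
        ≈⟨ hex-f e k ⟩
      f (suc e) (suc (suc k)) * (f e (suc k) * f (suc (suc e)) k)
        ≈⟨ *-cong eq₃ (*-cong eq₄ eq₅) ⟩
      g (suc e) (suc (suc k)) * (g e (suc k) * g (suc (suc e)) k)
        ≈⟨ ≈-sym (hex-g e k) ⟩
      g (suc e) k * (g e (suc (suc k)) * g (suc (suc e)) (suc k))
        ≈⟨ *-cong (≈-sym eq₁) (*-cong (≈-sym eq₂) ≈-refl) ⟩
      f (suc e) k * (f e (suc (suc k)) * g (suc (suc e)) (suc k))
        ≈⟨ ≈-sym (x∙yz≈y∙zx _ _ _) ⟩
      g (suc (suc e)) (suc k) * (f (suc e) k * f e (suc (suc k))) ∎)

    hexagon-unique : (∀ d k → Invertible (f d k)) →
                     (∀ k → f 0 k ≈ g 0 k) → (∀ k → f 1 k ≈ g 1 k) → (∀ d → f d 0 ≈ g d 0) →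
                     ∀ d k → f d k ≈ g d k
    hexagon-unique inv row₀ row₁ col₀ = agree
      where
      agree : ∀ d k → f d k ≈ g d k
      agree zero             k       = row₀ k
      agree (suc zero)       k       = row₁ k
      agree (suc (suc e))    zero    = col₀ (suc (suc e))
      agree (suc (suc e))    (suc k) =
        hexagon-step (*-invertible (inv (suc e) k) (inv e (suc (suc k))))
          (agree (suc e) k) (agree e (suc (suc k))) (agree (suc e) (suc (suc k)))
          (agree e (suc k)) (agree (suc (suc e)) k)

  module Factorisation {f : ℕ → ℕ → Carrier} (invertible : ∀ d k → Invertible (f d k)) where

    f⁻¹ : ℕ → ℕ → Carrier
    f⁻¹ d k = proj₁ (invertible d k)

    f*f⁻¹ : ∀ d k → f d k * f⁻¹ d k ≈ 1#
    f*f⁻¹ d k = proj₂ (invertible d k)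

    -- X telescopes the ratios f(1,k)/f(0,k), so that row 1 is matched; Y and Z then fit row 0
    -- and column 0.
    X X⁻¹ : ℕ → Carrier
    X zero    = 1#
    X (suc k) = X k * f 1 k * f⁻¹ 0 k
    X⁻¹ zero    = 1#
    X⁻¹ (suc k) = X⁻¹ k * f⁻¹ 1 k * f 0 k

    Y Z : ℕ → Carrier
    Y k = f 0 k * X⁻¹ k
    Z d = f d 0 * X⁻¹ d * f⁻¹ 0 0

    X*X⁻¹ : ∀ k → X k * X⁻¹ k ≈ 1#
    X*X⁻¹ zero    = *-identityˡ 1#
    X*X⁻¹ (suc k) = begin
      (X k * f 1 k * f⁻¹ 0 k) * (X⁻¹ k * f⁻¹ 1 k * f 0 k)
        ≈⟨ interchange₃ _ _ _ _ _ _ ⟩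
      (X k * X⁻¹ k) * (f 1 k * f⁻¹ 1 k) * (f⁻¹ 0 k * f 0 k)
        ≈⟨ *-cong (*-cong (X*X⁻¹ k) (f*f⁻¹ 1 k)) (≈-trans (*-comm _ _) (f*f⁻¹ 0 k)) ⟩
      1# * 1# * 1#
        ≈⟨ ≈-trans (*-identityʳ _) (*-identityʳ 1#) ⟩
      1# ∎

    Z₀≈1 : Z 0 ≈ 1#
    Z₀≈1 = ≈-trans (*-cong (*-identityʳ (f 0 0)) ≈-refl) (f*f⁻¹ 0 0)

    Z₁≈1 : Z 1 ≈ 1#
    Z₁≈1 = begin
      f 1 0 * (1# * f⁻¹ 1 0 * f 0 0) * f⁻¹ 0 0
        ≈⟨ solve 4 (λ a a⁻¹ b b⁻¹ → (a ⊕ ((id ⊕ a⁻¹) ⊕ b)) ⊕ b⁻¹ ⊜ (a ⊕ a⁻¹) ⊕ (b ⊕ b⁻¹))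
             ≈-refl (f 1 0) (f⁻¹ 1 0) (f 0 0) (f⁻¹ 0 0) ⟩
      (f 1 0 * f⁻¹ 1 0) * (f 0 0 * f⁻¹ 0 0)
        ≈⟨ *-≈1 (f*f⁻¹ 1 0) (f*f⁻¹ 0 0) ⟩
      1# ∎

    row₀ : ∀ k → f 0 k ≈ X k * Y k * Z 0
    row₀ k = ≈-sym (begin
      X k * (f 0 k * X⁻¹ k) * Z 0  ≈⟨ *-cong (x∙yz≈y∙xz _ _ _) Z₀≈1 ⟩
      f 0 k * (X k * X⁻¹ k) * 1#   ≈⟨ *-identityʳ _ ⟩
      f 0 k * (X k * X⁻¹ k)        ≈⟨ *-identityʳ-≈1 _ (X*X⁻¹ k) ⟩
      f 0 k                        ∎)

    row₁ : ∀ k → f 1 k ≈ X (suc k) * Y k * Z 1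
    row₁ k = ≈-sym (begin
      (X k * f 1 k * f⁻¹ 0 k) * (f 0 k * X⁻¹ k) * Z 1
        ≈⟨ *-cong (solve 5 (λ x a b⁻¹ b x⁻¹ → ((x ⊕ a) ⊕ b⁻¹) ⊕ (b ⊕ x⁻¹) ⊜ a ⊕ ((x ⊕ x⁻¹) ⊕ (b ⊕ b⁻¹)))
                     ≈-refl (X k) (f 1 k) (f⁻¹ 0 k) (f 0 k) (X⁻¹ k)) Z₁≈1 ⟩
      f 1 k * ((X k * X⁻¹ k) * (f 0 k * f⁻¹ 0 k)) * 1#
        ≈⟨ *-identityʳ _ ⟩
      f 1 k * ((X k * X⁻¹ k) * (f 0 k * f⁻¹ 0 k))
        ≈⟨ *-identityʳ-≈1 _ (*-≈1 (X*X⁻¹ k) (f*f⁻¹ 0 k)) ⟩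
      f 1 k ∎)

    col₀ : ∀ d → f d 0 ≈ X (d + 0) * Y 0 * Z d
    col₀ d = ≈-sym (begin
      X (d + 0) * (f 0 0 * 1#) * (f d 0 * X⁻¹ d * f⁻¹ 0 0)
        ≈⟨ *-cong (*-cong (≈-reflexive (cong X (ℕ.+-identityʳ d))) (*-identityʳ _)) ≈-refl ⟩
      X d * f 0 0 * (f d 0 * X⁻¹ d * f⁻¹ 0 0)
        ≈⟨ solve 5 (λ x a b x⁻¹ a⁻¹ → (x ⊕ a) ⊕ ((b ⊕ x⁻¹) ⊕ a⁻¹) ⊜ b ⊕ ((x ⊕ x⁻¹) ⊕ (a ⊕ a⁻¹)))
             ≈-refl (X d) (f 0 0) (f d 0) (X⁻¹ d) (f⁻¹ 0 0) ⟩
      f d 0 * ((X d * X⁻¹ d) * (f 0 0 * f⁻¹ 0 0))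
        ≈⟨ *-identityʳ-≈1 _ (*-≈1 (X*X⁻¹ d) (f*f⁻¹ 0 0)) ⟩
      f d 0 ∎)

    factorisation : Hexagon f → ∀ d k → f d k ≈ X (d + k) * Y k * Z d
    factorisation hex = hexagon-unique hex (factorised-hexagon X Y Z) invertible row₀ row₁ col₀

  -- Antidiagonal segments

  antidiagonal : (ℕ → ℕ → Carrier) → ℕ → ℕ → ℕ → Carrier
  antidiagonal M n k a = prod R (suc a) (λ i → M (n + i) (k + (a ∸ i)))

  sdr-lhs sdr-rhs : (ℕ → ℕ → Carrier) → ℕ → ℕ → ℕ → ℕ → Carrier
  sdr-lhs A n k p r = prod R (suc r) (λ i → A (n + i) (k + r ∸ i))
                    * prod R (p ∸ r) (λ i → A (n + p ∸ i) (k + r + i + 1))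
  sdr-rhs A n k p r = prod R (suc r) (λ i → A (n + p ∸ i) (k + p ∸ r + i))
                    * prod R (p ∸ r) (λ i → A (n + i) (k + p ∸ r ∸ i ∸ 1))

  AntidiagonalIdentity : (ℕ → ℕ → Carrier) → ℕ → ℕ → ℕ → ℕ → Set ℓ
  AntidiagonalIdentity A n k r q =
    antidiagonal A n k r * antidiagonal A (n + suc r) (k + suc r) q
    ≈ antidiagonal A (n + suc q) (k + suc q) r * antidiagonal A n k q

  module _ (A : ℕ → ℕ → Carrier) where

    sdr-lhs-antidiagonals : ∀ n k r q →
      sdr-lhs A n k (suc r + q) r ≈ antidiagonal A n k r * antidiagonal A (n + suc r) (k + suc r) q
    sdr-lhs-antidiagonals n k r q = *-cong
      (prod-cong (suc r) (λ i i≤r → entry-cong A refl (ℕ.+-∸-assoc k (ℕ.≤-pred i≤r))))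
      (begin
        prod R (suc r + q ∸ r) (λ i → A (n + (suc r + q) ∸ i) (k + r + i + 1))
          ≈⟨ prod-length _ (1+m+n∸m≡1+n r q) ⟩
        prod R (suc q) (λ i → A (n + (suc r + q) ∸ i) (k + r + i + 1))
          ≈⟨ prod-cong (suc q) (λ i i<1+q → entry-cong A
               (m+[n+o]∸p≡m+n+[o∸p] n (suc r) (ℕ.≤-pred i<1+q))
               (≡.trans (reassoc k r i) (cong (k + suc r +_) (≡.sym (ℕ.m∸[m∸n]≡n (ℕ.≤-pred i<1+q)))))) ⟩
        prod R (suc q) (λ i → A (n + suc r + (q ∸ i)) (k + suc r + (q ∸ (q ∸ i))))
          ≈⟨ prod-reverse q (λ j → A (n + suc r + j) (k + suc r + (q ∸ j))) ⟩
        antidiagonal A (n + suc r) (k + suc r) q ∎)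
      where
      reassoc : ∀ k r i → k + r + i + 1 ≡ k + suc r + i
      reassoc = solve-∀

    sdr-rhs-antidiagonals : ∀ n k r q →
      sdr-rhs A n k (suc r + q) r ≈ antidiagonal A (n + suc q) (k + suc q) r * antidiagonal A n k q
    sdr-rhs-antidiagonals n k r q = *-cong
      (begin
        prod R (suc r) (λ i → A (n + (suc r + q) ∸ i) (k + (suc r + q) ∸ r + i))
          ≈⟨ prod-cong (suc r) (λ i i<1+r → entry-cong A
               (≡.trans (cong (λ p → n + p ∸ i) (cong suc (ℕ.+-comm r q)))
                        (m+[n+o]∸p≡m+n+[o∸p] n (suc q) (ℕ.≤-pred i<1+r)))
               (cong₂ _+_ (m+[1+n+o]∸n≡m+[1+o] k r q) (≡.sym (ℕ.m∸[m∸n]≡n (ℕ.≤-pred i<1+r))))) ⟩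
        prod R (suc r) (λ i → A (n + suc q + (r ∸ i)) (k + suc q + (r ∸ (r ∸ i))))
          ≈⟨ prod-reverse r (λ j → A (n + suc q + j) (k + suc q + (r ∸ j))) ⟩
        antidiagonal A (n + suc q) (k + suc q) r ∎)
      (begin
        prod R (suc r + q ∸ r) (λ i → A (n + i) (k + (suc r + q) ∸ r ∸ i ∸ 1))
          ≈⟨ prod-length _ (1+m+n∸m≡1+n r q) ⟩
        prod R (suc q) (λ i → A (n + i) (k + (suc r + q) ∸ r ∸ i ∸ 1))
          ≈⟨ prod-cong (suc q) (λ i i<1+q → entry-cong A refl
               (≡.trans (cong (λ x → x ∸ i ∸ 1) (m+[1+n+o]∸n≡m+[1+o] k r q))
                        (m+[1+n]∸o∸1≡m+[n∸o] k (ℕ.≤-pred i<1+q)))) ⟩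
        antidiagonal A n k q ∎)

    SDR-of-antidiagonal-identities : (∀ n k r q → AntidiagonalIdentity A n k r q) → ∀ m → SDR R m A
    SDR-of-antidiagonal-identities identity m n k p r _ _ r<p with ℕ.m≤n⇒∃[o]m+o≡n r<p
    ... | q , refl = begin
      sdr-lhs A n k (suc r + q) r                                          ≈⟨ sdr-lhs-antidiagonals n k r q ⟩
      antidiagonal A n k r * antidiagonal A (n + suc r) (k + suc r) q      ≈⟨ identity n k r q ⟩
      antidiagonal A (n + suc q) (k + suc q) r * antidiagonal A n k q      ≈⟨ ≈-sym (sdr-rhs-antidiagonals n k r q) ⟩
      sdr-rhs A n k (suc r + q) r                                          ∎

  SDR-mono : ∀ {m m′} (A : ℕ → ℕ → Carrier) → m ≤ m′ → SDR R m′ A → SDR R m A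
  SDR-mono A m≤m′ sdr n k p r 2≤p p<m r<p = sdr n k p r 2≤p (ℕ.≤-trans p<m m≤m′) r<p

  antidiagonal-zero : ∀ (M : ℕ → ℕ → Carrier) n k → antidiagonal M n k 0 ≈ M n k
  antidiagonal-zero M n k =
    ≈-trans (*-identityˡ _) (entry-cong M (ℕ.+-identityʳ n) (ℕ.+-identityʳ k))

  antidiagonal-one : ∀ (M : ℕ → ℕ → Carrier) n k → antidiagonal M n k 1 ≈ M n (suc k) * M (suc n) k
  antidiagonal-one M n k = *-cong
    (≈-trans (*-identityˡ _) (entry-cong M (ℕ.+-identityʳ n) (ℕ.+-comm k 1)))
    (entry-cong M (ℕ.+-comm n 1) (ℕ.+-identityʳ k))

  hexagon-of-SDR : ∀ {m} (A : ℕ → ℕ → Carrier) → 3 ≤ m → SDR R m A → Hexagon (λ d k → A (d + k) k)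
  hexagon-of-SDR A 3≤m sdr e k = begin
    A n k * (A (e + suc (suc k)) (suc (suc k)) * A (suc (suc e) + suc k) (suc k))
      ≈⟨ *-cong (≈-sym (antidiagonal-zero A n k))
                (≈-sym (≈-trans (antidiagonal-one A (n + 1) (k + 1))
                                (*-cong (entry-cong A ([1+e+k]+1≡e+[2+k] e k) (cong suc (ℕ.+-comm k 1)))
                                        (entry-cong A (1+[1+e+k+1]≡[2+e]+[1+k] e k) (ℕ.+-comm k 1))))) ⟩
    antidiagonal A n k 0 * antidiagonal A (n + 1) (k + 1) 1
      ≈⟨ ≈-sym (sdr-lhs-antidiagonals A n k 0 1) ⟩
    sdr-lhs A n k 2 0
      ≈⟨ sdr n k 2 0 (s≤s (s≤s z≤n)) 3≤m (s≤s z≤n) ⟩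
    sdr-rhs A n k 2 0
      ≈⟨ sdr-rhs-antidiagonals A n k 0 1 ⟩
    antidiagonal A (n + 2) (k + 2) 0 * antidiagonal A n k 1
      ≈⟨ *-cong (≈-trans (antidiagonal-zero A (n + 2) (k + 2)) (entry-cong A ([1+e+k]+2≡[1+e]+[2+k] e k) (ℕ.+-comm k 2)))
                (≈-trans (antidiagonal-one A n k) (*-cong (entry-cong A (≡.sym (ℕ.+-suc e k)) refl) ≈-refl)) ⟩
    A (suc e + suc (suc k)) (suc (suc k)) * (A (e + suc k) (suc k) * A (suc (suc e) + k) k) ∎
    where
    n = suc (e + k)
    [1+e+k]+1≡e+[2+k] : ∀ e k → suc (e + k) + 1 ≡ e + suc (suc k)
    [1+e+k]+1≡e+[2+k] = solve-∀
    1+[1+e+k+1]≡[2+e]+[1+k] : ∀ e k → suc (suc (e + k) + 1) ≡ suc (suc e) + suc k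
    1+[1+e+k+1]≡[2+e]+[1+k] = solve-∀
    [1+e+k]+2≡[1+e]+[2+k] : ∀ e k → suc (e + k) + 2 ≡ suc e + suc (suc k)
    [1+e+k]+2≡[1+e]+[2+k] = solve-∀

  module _ {A : ℕ → ℕ → Carrier} (lower : IsLowerTriangular R A) where

    antidiagonal-vanishes : ∀ n k a → n < k + a → antidiagonal A n k a ≈ 0#
    antidiagonal-vanishes n k a n<k+a =
      prod-zero (λ i → A (n + i) (k + (a ∸ i))) (s≤s z≤n) (lower (n + 0) (k + a) (≡.subst (_< k + a) (≡.sym (ℕ.+-identityʳ n)) n<k+a))

    module _ (X Y Z : ℕ → Carrier) (factorised : ∀ d k → A (d + k) k ≈ X (d + k) * Y k * Z d) where

      entry-factorised : ∀ {n k} → k ≤ n → A n k ≈ X n * Y k * Z (n ∸ k)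
      entry-factorised {n} {k} k≤n =
        ≡.subst (λ x → A x k ≈ X x * Y k * Z (n ∸ k)) (ℕ.m∸n+n≡m k≤n) (factorised (n ∸ k) k)

      toeplitz : ℕ → ℕ → Carrier
      toeplitz i j = Z (i ∸ j)

      antidiagonal-factorised : ∀ n k a → k + a ≤ n →
        antidiagonal A n k a ≈ segment X n a * segment Y k a * antidiagonal toeplitz n k a
      antidiagonal-factorised n k a k+a≤n = begin
        antidiagonal A n k a
          ≈⟨ prod-cong (suc a) (λ i i<1+a → entry-factorised (in-triangle (ℕ.≤-pred i<1+a))) ⟩
        prod R (suc a) (λ i → X (n + i) * Y (k + (a ∸ i)) * Z (n + i ∸ (k + (a ∸ i))))
          ≈⟨ ≈-trans (prod-distrib-* (suc a) _ _) (*-cong (prod-distrib-* (suc a) _ _) ≈-refl) ⟩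
        segment X n a * prod R (suc a) (λ i → Y (k + (a ∸ i))) * antidiagonal toeplitz n k a
          ≈⟨ *-cong (*-cong ≈-refl (prod-reverse a (λ j → Y (k + j)))) ≈-refl ⟩
        segment X n a * segment Y k a * antidiagonal toeplitz n k a ∎
        where
        in-triangle : ∀ {i} → i ≤ a → k + (a ∸ i) ≤ n + i
        in-triangle {i} _ = ℕ.≤-trans (ℕ.+-monoʳ-≤ k (ℕ.m∸n≤m a i)) (ℕ.≤-trans k+a≤n (ℕ.m≤m+n n i))

      toeplitz-shift : ∀ n k s a → antidiagonal toeplitz (n + s) (k + s) a ≈ antidiagonal toeplitz n k a
      toeplitz-shift n k s a =
        prod-cong (suc a) (λ i _ → ≈-reflexive (cong Z ([m+o+i]∸[n+o+j]≡[m+i]∸[n+j] n k s i (a ∸ i))))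

      antidiagonal-identity-in-triangle : ∀ {n k r q} → k + r ≤ n → k + q ≤ n → AntidiagonalIdentity A n k r q
      antidiagonal-identity-in-triangle {n} {k} {r} {q} k+r≤n k+q≤n = begin
        antidiagonal A n k r * antidiagonal A (n + suc r) (k + suc r) q
          ≈⟨ *-cong (antidiagonal-factorised n k r k+r≤n)
                    (antidiagonal-factorised (n + suc r) (k + suc r) q (+-shift-≤ k q (suc r) k+q≤n)) ⟩
        (segment X n r * segment Y k r * D n k r)
          * (segment X (n + suc r) q * segment Y (k + suc r) q * D (n + suc r) (k + suc r) q)
          ≈⟨ interchange₃ _ _ _ _ _ _ ⟩
        (segment X n r * segment X (n + suc r) q) * (segment Y k r * segment Y (k + suc r) q)
          * (D n k r * D (n + suc r) (k + suc r) q)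
          ≈⟨ *-cong (*-cong (segment-swap X n r q) (segment-swap Y k r q))
                    (*-cong (≈-sym (toeplitz-shift n k (suc q) r)) (toeplitz-shift n k (suc r) q)) ⟩
        (segment X (n + suc q) r * segment X n q) * (segment Y (k + suc q) r * segment Y k q)
          * (D (n + suc q) (k + suc q) r * D n k q)
          ≈⟨ ≈-sym (interchange₃ _ _ _ _ _ _) ⟩
        (segment X (n + suc q) r * segment Y (k + suc q) r * D (n + suc q) (k + suc q) r)
          * (segment X n q * segment Y k q * D n k q)
          ≈⟨ ≈-sym (*-cong (antidiagonal-factorised (n + suc q) (k + suc q) r (+-shift-≤ k r (suc q) k+r≤n))
                             (antidiagonal-factorised n k q k+q≤n)) ⟩
        antidiagonal A (n + suc q) (k + suc q) r * antidiagonal A n k q ∎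
        where
        D = antidiagonal toeplitz

      antidiagonal-identity : ∀ n k r q → AntidiagonalIdentity A n k r q
      antidiagonal-identity n k r q with n <? k + r | n <? k + q
      ... | yes n<k+r | _ =
        *-cong-zeroˡ (antidiagonal-vanishes n k r n<k+r)
                     (antidiagonal-vanishes (n + suc q) (k + suc q) r (+-shift-< k r (suc q) n<k+r))
      ... | no _ | yes n<k+q =
        *-cong-zeroʳ (antidiagonal-vanishes (n + suc r) (k + suc r) q (+-shift-< k q (suc r) n<k+q))
                     (antidiagonal-vanishes n k q n<k+q)
      ... | no n≮k+r | no n≮k+q = antidiagonal-identity-in-triangle (ℕ.≮⇒≥ n≮k+r) (ℕ.≮⇒≥ n≮k+q)

theorem2p3 : ∀ {c ℓ : Level} (R : CommutativeRing c ℓ) → IsField R →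
    (m : ℕ) → 3 ≤ m →
    (A : ℕ → ℕ → CommutativeRing.Carrier R) →
    IsLowerTriangular R A →
    (∀ n k → k ≤ n → ¬ (CommutativeRing._≈_ R (A n k) (CommutativeRing.0# R))) →
    (SDR R (Data.Nat.suc m) A → SDR R m A) × (SDR R m A → SDR R (Data.Nat.suc m) A)
theorem2p3 R (_ , inverse) m 3≤m A lower nonzero =
    SDR-mono R A (ℕ.n≤1+n m)
  , λ sdr → SDR-of-antidiagonal-identities R A
              (antidiagonal-identity R lower X Y Z (factorisation (hexagon-of-SDR R A 3≤m sdr))) (suc m)
  where
  invertible : ∀ d k → Invertible R (A (d + k) k)
  invertible d k = inverse (A (d + k) k) (nonzero (d + k) k (ℕ.m≤n+m k d))
  open Factorisation R invertible using (X; Y; Z; factorisation)
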